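{- Let $G$ be a finite connected graph with edges $e_1,\dots,e_m$, let $k_1,\dots,k_m$ be positive integers and let $u\in V(G)$. For each vertex $v$ let $e^v_1,\dots,e^v_{\deg(v)}$ be the edges incident to $v$ and $k^v_j$ the $k_i$ with $e_i=e^v_j$. Then $$\mathrm{WB}_G(k_1,\dots,k_m;u)\;\ge\;\prod_{v\in V(G)}\binom{k^v_1+k^v_2+\dots+k^v_{\deg(v)}-\deg(v)}{k^v_1-1,\,k^v_2-1,\,\dots,\,k^v_{\deg(v)}-1}.$$
   Context: A tour on a graph is a walk $v_0,f_1,v_1,\dots,f_\ell,v_\ell$ with $v_\ell=v_0$, starting and ending at $v_0$. A tour is balanced if each edge is traversed equally often in each direction. $\mathrm{WB}_G(k_1,\dots,k_m;u)$ denotes the number of balanced tours on $G$ starting and ending at $u$ that traverse each edge $e_i$ exactly $k_i$ times in each direction. $\binom{n}{a_1,\dots,a_r}=\frac{n!}{a_1!\cdots a_r!}$ for $n=a_1+\dots+a_r$ is the multinomial coefficient. -}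

module Defs where

open import Data.Nat using (ℕ; zero; suc; _+_; _*_; _∸_; _/_; NonZero; _≡ᵇ_; _!)
open import Data.Nat.ListAction using (sum; product)
open import Data.Nat.Properties using (_!≢0; m*n≢0)
open import Data.Fin using (Fin)
open import Data.Fin.Properties using () renaming (_≟_ to _≟F_)
open import Data.Bool using (Bool; true; false; _∧_; _∨_; if_then_else_)
open import Data.Bool.Properties using () renaming (_≟_ to _≟B_)
open import Data.List using (List; []; _∷_; map; length; allFin; filterᵇ; concatMap)
open import Data.Bool.ListAction using (and)
open import Data.Product using (_×_; _,_; proj₁; proj₂; ∃)
open import Data.Sum using (_⊎_)
open import Relation.Binary.PropositionalEquality using (_≡_; _≢_)
open import Relation.Nullary.Decidable using (⌊_⌋)

-- Finite simple graphs: vertices Fin n, edges Fin m, edge i joins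
-- src i and tgt i (an arbitrary orientation, used only to name the two
-- traversal directions).

record Graph : Set where
  field
    n     : ℕ
    m     : ℕ
    src   : Fin m → Fin n
    tgt   : Fin m → Fin n
    noLoop : ∀ i → src i ≢ tgt i
    noMulti : ∀ i j → ((src i ≡ src j × tgt i ≡ tgt j) ⊎ (src i ≡ tgt j × tgt i ≡ src j)) → i ≡ j

open Graph public

Adj : (G : Graph) → Fin (n G) → Fin (n G) → Set
Adj G v w = ∃ λ i → (src G i ≡ v × tgt G i ≡ w) ⊎ (src G i ≡ w × tgt G i ≡ v)

data Reach (G : Graph) : Fin (n G) → Fin (n G) → Set where
  here : ∀ {v} → Reach G v v
  step : ∀ {v w x} → Adj G v w → Reach G w x → Reach G v x

Connected : Graph → Set
Connected G = ∀ v w → Reach G v w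

-- Darts: an edge together with a traversal direction.
-- (i , true) goes src i → tgt i ; (i , false) goes tgt i → src i.

Dart : Graph → Set
Dart G = Fin (m G) × Bool

dtail : (G : Graph) → Dart G → Fin (n G)
dtail G (i , true)  = src G i
dtail G (i , false) = tgt G i

dhead : (G : Graph) → Dart G → Fin (n G)
dhead G (i , true)  = tgt G i
dhead G (i , false) = src G i

-- A tour v0, f1, v1, ..., fℓ, vℓ is encoded by its list of traversed
-- darts f1..fℓ (vertices are determined by the darts).
-- isWalkᵇ G u v ds : the darts ds form a walk from v ending at u.
isWalkᵇ : (G : Graph) → Fin (n G) → Fin (n G) → List (Dart G) → Bool
isWalkᵇ G u v []       = ⌊ v ≟F u ⌋
isWalkᵇ G u v (d ∷ ds) = ⌊ dtail G d ≟F v ⌋ ∧ isWalkᵇ G u (dhead G d) ds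

_≟D_ : ∀ {G} → (d e : Dart G) → Bool
(i , b) ≟D (j , c) = ⌊ i ≟F j ⌋ ∧ ⌊ b ≟B c ⌋

countDart : (G : Graph) → Dart G → List (Dart G) → ℕ
countDart G d ds = length (filterᵇ (λ e → _≟D_ {G} e d) ds)

hasCountsᵇ : (G : Graph) → (Fin (m G) → ℕ) → List (Dart G) → Bool
hasCountsᵇ G k ds =
  and (map (λ i → (countDart G (i , true) ds ≡ᵇ k i) ∧ (countDart G (i , false) ds ≡ᵇ k i))
      (allFin (m G)))

allDarts : (G : Graph) → List (Dart G)
allDarts G = concatMap (λ i → (i , true) ∷ (i , false) ∷ []) (allFin (m G))

seqs : (G : Graph) → ℕ → List (List (Dart G))
seqs G zero    = [] ∷ []
seqs G (suc L) = concatMap (λ d → map (d ∷_) (seqs G L)) (allDarts G)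

-- WB_G(k; u): number of balanced tours at u using each edge exactly k i
-- times in each direction.  Such a tour has length exactly 2 * Σ k i,
-- so enumerating all dart sequences of that length counts them all.
WB : (G : Graph) → (Fin (m G) → ℕ) → Fin (n G) → ℕ
WB G k u = length (filterᵇ (λ ds → isWalkᵇ G u u ds ∧ hasCountsᵇ G k ds)
                           (seqs G (2 * sum (map k (allFin (m G))))))

prod!≢0 : (as : List ℕ) → NonZero (product (map (λ a → a !) as))
prod!≢0 []       = _
prod!≢0 (a ∷ as) = m*n≢0 (a !) (product (map (λ a → a !) as)) {{a !≢0}} {{prod!≢0 as}}

multinomial : List ℕ → ℕ
multinomial as = ((sum as) ! / product (map (λ a → a !) as)) {{prod!≢0 as}}

incident : (G : Graph) → Fin (n G) → List (Fin (m G))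
incident G v = filterᵇ (λ i → ⌊ src G i ≟F v ⌋ ∨ ⌊ tgt G i ≟F v ⌋) (allFin (m G))

localFactor : (G : Graph) → (Fin (m G) → ℕ) → Fin (n G) → ℕ
localFactor G k v = multinomial (map (λ i → k i ∸ 1) (incident G v))

boundWB : (G : Graph) → (Fin (m G) → ℕ) → ℕ
boundWB G k = product (map (localFactor G k) (allFin (n G)))

-- A BEST-theorem style injection.  Fix a shortest-path tree towards u, so
-- that every v ≠ u has a parent edge leading to a vertex of smaller depth.
-- An arrangement chooses at each vertex v a word in which every incident
-- edge e_i occurs k_i − 1 times; the number of arrangements is the product
-- of the multinomial coefficients.  Appending every incident edge once more,
-- the parent edge last, turns the word at v into a queue of darts leaving v
-- in which the dart along e_i occurs k_i times.  Start at u and always leave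
-- the current vertex by the next dart of its queue.  The walk can only get
-- stuck at u, and by induction on depth every queue is emptied: if the last
-- dart of v's queue, towards its parent w, were unused, then w would be
-- entered fewer times than it is left, while a closed walk is balanced at
-- every vertex.  So the walk is a balanced tour at u, and as the darts
-- leaving v along the tour are exactly v's queue, distinct arrangements give
-- distinct tours.

module Submission where

open import Algebra.Properties.CommutativeSemigroup as CommSemigroupProperties using ()
open import Data.Bool using (Bool; true; false; _∧_; _∨_; not; if_then_else_; T?)
open import Data.Bool.ListAction using (and)
open import Data.Bool.Properties using (∨-zeroʳ; T-≡) renaming (_≟_ to _≟B_)
open import Data.Fin using (Fin; zero; suc)
import Data.Fin.Properties as Fin
open import Data.Fin.Properties using (any?) renaming (_≟_ to _≟F_)
open import Data.List using (List; []; _∷_; _++_; [_]; map; length; filterᵇ; allFin; tabulate; concatMap; replicate; cartesianProductWith)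
open import Data.List.Membership.Propositional using (_∈_; _∉_; find)
open import Data.List.Membership.Propositional.Properties
  using (∈-filter⁺; ∈-filter⁻; ∈-++⁻; ∈-++⁺ˡ; ∈-++⁺ʳ; ∈-map⁺; ∈-map⁻; ∈-allFin; ∈-concatMap⁺; ∈-concatMap⁻; ∈-cartesianProductWith⁻)
open import Data.List.Properties
  using (++-assoc; ++-cancelʳ; ++-conicalʳ; ++-identityʳ; filter-++; length-++; length-map; map-++; map-injective; map-tabulate;
         tabulate-cong; ∷-injective; ∷-injectiveʳ)
open import Data.List.Relation.Binary.Disjoint.Propositional using (Disjoint)
open import Data.List.Relation.Unary.All using (All; []; _∷_)
import Data.List.Relation.Unary.All as All
import Data.List.Relation.Unary.All.Properties as All
open import Data.List.Relation.Unary.AllPairs using (AllPairs; []; _∷_)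
import Data.List.Relation.Unary.AllPairs.Properties as AllPairs
open import Data.List.Relation.Unary.Any using (here; there)
import Data.List.Relation.Unary.Any as Any
open import Data.List.Relation.Unary.Unique.Propositional using (Unique)
import Data.List.Relation.Unary.Unique.Propositional.Properties as Unique
open import Data.Nat using (ℕ; zero; suc; _+_; _*_; _∸_; _≤_; _<_; _>_; z≤n; s≤s; z<s; _!; _≡ᵇ_)
open import Data.Nat.Combinatorics using (_C_; nCk≡n!/k![n-k]!; k![n∸k]!∣n!; nCn≡1; nCk+nC[k+1]≡[n+1]C[k+1])
open import Data.Nat.DivMod using (_/_; m/n*n≡m; m*n/n≡m; /-congˡ)
open import Data.Nat.ListAction using (sum; product)
open import Data.Nat.Properties
open import Data.Nat.Tactic.RingSolver using (solve-∀)
open import Data.Product using (∃; _×_; _,_; proj₁; proj₂)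
import Data.Product
open import Data.Sum using (_⊎_; inj₁; inj₂)
import Data.Sum
open import Data.Vec using (Vec; []; _∷_; lookup)
import Data.Vec.Properties as Vec
open import Data.Vec.Functional using (Vector; updateAt)
open import Data.Vec.Functional.Properties using (updateAt-updates; updateAt-minimal)
open import Defs
open import Function using (_∘_; id; const)
open import Function.Bundles using (Equivalence)
open import Relation.Binary.Definitions using (DecidableEquality)
open import Relation.Binary.PropositionalEquality hiding ([_])
open import Relation.Nullary using (¬_; Dec; yes; no; contradiction)
open import Relation.Nullary.Decidable using (⌊_⌋; _⊎-dec_; _×-dec_)
open import Relation.Unary using (Decidable)

module +-CS = CommSemigroupProperties +-commutativeSemigroup

⌊⌋-true : ∀ {P : Set} (p? : Dec P) → P → ⌊ p? ⌋ ≡ true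
⌊⌋-true (yes _) _ = refl
⌊⌋-true (no ¬p) p = contradiction p ¬p

⌊⌋-false : ∀ {P : Set} (p? : Dec P) → ¬ P → ⌊ p? ⌋ ≡ false
⌊⌋-false (yes p) ¬p = contradiction p ¬p
⌊⌋-false (no _) _ = refl

⌊⌋-sound : ∀ {P : Set} (p? : Dec P) → ⌊ p? ⌋ ≡ true → P
⌊⌋-sound (yes p) _ = p

module _ {A : Set} where

  ∉-all⇒[] : ∀ (xs : List A) → (∀ {x} → x ∉ xs) → xs ≡ []
  ∉-all⇒[] [] _ = refl
  ∉-all⇒[] (x ∷ xs) ∉xs = contradiction (here refl) ∉xs

  last-∈-suffix : ∀ (ys zs xs : List A) {p} → ys ++ zs ≡ xs ++ [ p ] → zs ≢ [] → p ∈ zs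
  last-∈-suffix [] zs xs {p} eq _ = subst (p ∈_) (sym eq) (∈-++⁺ʳ xs (here refl))
  last-∈-suffix (y ∷ ys) zs [] eq zs≢[] = contradiction (++-conicalʳ ys zs (∷-injectiveʳ eq)) zs≢[]
  last-∈-suffix (y ∷ ys) zs (x ∷ xs) eq zs≢[] = last-∈-suffix ys zs xs (∷-injectiveʳ eq) zs≢[]

m≤o⇒n≤o⇒m+n≡o+o⇒m≡o : ∀ {m n o} → m ≤ o → n ≤ o → m + n ≡ o + o → m ≡ o
m≤o⇒n≤o⇒m+n≡o+o⇒m≡o m≤o n≤o m+n≡o+o with m≤n⇒m<n∨m≡n m≤o
... | inj₂ m≡o = m≡o
... | inj₁ m<o = contradiction m+n≡o+o (<⇒≢ (+-mono-<-≤ m<o n≤o))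

least : ∀ {P : ℕ → Set} → Decidable P → ∀ {b} → P b → ∃ λ t → P t × (∀ {s} → P s → t ≤ s)
least P? {zero} p = 0 , p , λ _ → z≤n
least P? {suc b} p with P? 0
... | yes p0 = 0 , p0 , λ _ → z≤n
... | no ¬p0 with t , pt , minimal ← least (P? ∘ suc) {b} p =
  suc t , pt , λ { {zero} p0 → contradiction p0 ¬p0 ; {suc s} ps → s≤s (minimal ps) }

and-map-true : ∀ {A : Set} (f : A → Bool) xs → (∀ x → f x ≡ true) → and (map f xs) ≡ true
and-map-true f [] _ = refl
and-map-true f (x ∷ xs) all-true rewrite all-true x = and-map-true f xs all-true

≡⇒≡ᵇ-true : ∀ {a b} → a ≡ b → (a ≡ᵇ b) ≡ true
≡⇒≡ᵇ-true {a} {b} a≡b = Equivalence.to T-≡ (≡⇒≡ᵇ a b a≡b)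

module _ {A : Set} where

  filterᵇ-accept : ∀ {p : A → Bool} x xs → p x ≡ true → filterᵇ p (x ∷ xs) ≡ x ∷ filterᵇ p xs
  filterᵇ-accept {p} x xs px rewrite px = refl

  filterᵇ-reject : ∀ {p : A → Bool} x xs → p x ≡ false → filterᵇ p (x ∷ xs) ≡ filterᵇ p xs
  filterᵇ-reject {p} x xs px rewrite px = refl

  ∈-filterᵇ⁺ : ∀ {p : A → Bool} {x xs} → x ∈ xs → p x ≡ true → x ∈ filterᵇ p xs
  ∈-filterᵇ⁺ {p} x∈ px = ∈-filter⁺ (T? ∘ p) x∈ (Equivalence.from T-≡ px)

  ∈-filterᵇ⁻ : ∀ {p : A → Bool} {x} xs → x ∈ filterᵇ p xs → x ∈ xs × p x ≡ true
  ∈-filterᵇ⁻ {p} xs x∈ = Data.Product.map₂ (Equivalence.to T-≡) (∈-filter⁻ (T? ∘ p) {xs = xs} x∈)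

  countᵇ : (A → Bool) → List A → ℕ
  countᵇ p xs = length (filterᵇ p xs)

  countᵇ-∷ : ∀ p x xs → countᵇ p (x ∷ xs) ≡ (if p x then 1 else 0) + countᵇ p xs
  countᵇ-∷ p x xs with p x
  ... | true = refl
  ... | false = refl

  countᵇ-true : ∀ xs → countᵇ (λ _ → true) xs ≡ length xs
  countᵇ-true [] = refl
  countᵇ-true (x ∷ xs) = cong suc (countᵇ-true xs)

  countᵇ-++ : ∀ p xs ys → countᵇ p (xs ++ ys) ≡ countᵇ p xs + countᵇ p ys
  countᵇ-++ p xs ys = trans (cong length (filter-++ _ xs ys)) (length-++ (filterᵇ p xs))

  countᵇ-cong : ∀ {p q} → (∀ x → p x ≡ q x) → ∀ xs → countᵇ p xs ≡ countᵇ q xs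
  countᵇ-cong p≗q [] = refl
  countᵇ-cong {p} {q} p≗q (x ∷ xs) = begin
    countᵇ p (x ∷ xs)                       ≡⟨ countᵇ-∷ p x xs ⟩
    (if p x then 1 else 0) + countᵇ p xs    ≡⟨ cong₂ (λ b c → (if b then 1 else 0) + c) (p≗q x) (countᵇ-cong p≗q xs) ⟩
    (if q x then 1 else 0) + countᵇ q xs    ≡⟨ countᵇ-∷ q x xs ⟨
    countᵇ q (x ∷ xs)                       ∎
    where open ≡-Reasoning

  countᵇ-none : ∀ p xs → (∀ x → x ∈ xs → p x ≡ false) → countᵇ p xs ≡ 0
  countᵇ-none p [] _ = refl
  countᵇ-none p (x ∷ xs) none rewrite countᵇ-∷ p x xs | none x (here refl) =
    countᵇ-none p xs (λ y y∈ → none y (there y∈))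

  countᵇ-pos : ∀ p {x} xs → x ∈ xs → p x ≡ true → 1 ≤ countᵇ p xs
  countᵇ-pos p (y ∷ xs) (here refl) px rewrite countᵇ-∷ p y xs | px = s≤s z≤n
  countᵇ-pos p (y ∷ xs) (there x∈) px rewrite countᵇ-∷ p y xs =
    ≤-trans (countᵇ-pos p xs x∈ px) (m≤n+m _ _)

  countᵇ-filterᵇ : ∀ p q xs → (∀ x → p x ≡ true → q x ≡ true) → countᵇ p (filterᵇ q xs) ≡ countᵇ p xs
  countᵇ-filterᵇ p q [] _ = refl
  countᵇ-filterᵇ p q (x ∷ xs) p⇒q with q x in qx
  ... | true rewrite countᵇ-∷ p x (filterᵇ q xs) | countᵇ-∷ p x xs =
    cong (_ +_) (countᵇ-filterᵇ p q xs p⇒q)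
  ... | false with p x in px
  ...   | true = contradiction (trans (sym (p⇒q x px)) qx) λ ()
  ...   | false = countᵇ-filterᵇ p q xs p⇒q

module _ {A B : Set} where

  countᵇ-map : ∀ (p : B → Bool) (g : A → B) xs → countᵇ p (map g xs) ≡ countᵇ (p ∘ g) xs
  countᵇ-map p g [] = refl
  countᵇ-map p g (x ∷ xs) rewrite countᵇ-∷ p (g x) (map g xs) | countᵇ-∷ (p ∘ g) x xs =
    cong (_ +_) (countᵇ-map p g xs)

∑ : ∀ {n} → (Fin n → ℕ) → ℕ
∑ f = sum (tabulate f)

∑-cong : ∀ {n} {f g : Fin n → ℕ} → (∀ i → f i ≡ g i) → ∑ f ≡ ∑ g
∑-cong {zero} f≗g = refl
∑-cong {suc n} f≗g = cong₂ _+_ (f≗g zero) (∑-cong (f≗g ∘ suc))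

∑-zero : ∀ n → ∑ {n} (λ _ → 0) ≡ 0
∑-zero zero = refl
∑-zero (suc n) = ∑-zero n

∑-distrib-+ : ∀ {n} (f g : Fin n → ℕ) → ∑ (λ i → f i + g i) ≡ ∑ f + ∑ g
∑-distrib-+ {zero} f g = refl
∑-distrib-+ {suc n} f g =
  trans (cong (f zero + g zero +_) (∑-distrib-+ (f ∘ suc) (g ∘ suc)))
        (+-CS.interchange (f zero) (g zero) (∑ (f ∘ suc)) (∑ (g ∘ suc)))

∑-single : ∀ {n} (f : Fin n → ℕ) j → (∀ i → i ≢ j → f i ≡ 0) → ∑ f ≡ f j
∑-single {suc n} f zero others =
  trans (cong (f zero +_) (trans (∑-cong (λ i → others (suc i) λ ())) (∑-zero n))) (+-identityʳ _)
∑-single {suc n} f (suc j) others rewrite others zero (λ ()) =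
  ∑-single (f ∘ suc) j (λ i i≢j → others (suc i) (i≢j ∘ Fin.suc-injective))

∑-mono-≤ : ∀ {n} {f g : Fin n → ℕ} → (∀ i → f i ≤ g i) → ∑ f ≤ ∑ g
∑-mono-≤ {zero} f≤g = z≤n
∑-mono-≤ {suc n} f≤g = +-mono-≤ (f≤g zero) (∑-mono-≤ (f≤g ∘ suc))

∑-mono-< : ∀ {n} {f g : Fin n → ℕ} → (∀ i → f i ≤ g i) → ∀ j → f j < g j → ∑ f < ∑ g
∑-mono-< {suc n} f≤g zero fj<gj = +-mono-<-≤ fj<gj (∑-mono-≤ (f≤g ∘ suc))
∑-mono-< {suc n} f≤g (suc j) fj<gj = +-mono-≤-< (f≤g zero) (∑-mono-< (f≤g ∘ suc) j fj<gj)

∑-≤-≡⇒≡ : ∀ {n} {f g : Fin n → ℕ} → (∀ i → f i ≤ g i) → ∑ f ≡ ∑ g → ∀ i → f i ≡ g i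
∑-≤-≡⇒≡ f≤g ∑f≡∑g i with m≤n⇒m<n∨m≡n (f≤g i)
... | inj₂ fi≡gi = fi≡gi
... | inj₁ fi<gi = contradiction ∑f≡∑g (<⇒≢ (∑-mono-< f≤g i fi<gi))

module _ {A : Set} where

  private
    remove : ∀ {x : A} ys → x ∈ ys → List A
    remove (y ∷ ys) (here _) = ys
    remove (y ∷ ys) (there x∈) = y ∷ remove ys x∈

    length-remove : ∀ {x : A} ys (x∈ : x ∈ ys) → suc (length (remove ys x∈)) ≡ length ys
    length-remove (y ∷ ys) (here _) = refl
    length-remove (y ∷ ys) (there x∈) = cong suc (length-remove ys x∈)

    ∈-remove : ∀ {x z : A} ys (x∈ : x ∈ ys) → z ∈ ys → x ≢ z → z ∈ remove ys x∈
    ∈-remove (y ∷ ys) (here refl) (here refl) x≢z = contradiction refl x≢z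
    ∈-remove (y ∷ ys) (here _) (there z∈) _ = z∈
    ∈-remove (y ∷ ys) (there x∈) (here refl) _ = here refl
    ∈-remove (y ∷ ys) (there x∈) (there z∈) x≢z = there (∈-remove ys x∈ z∈ x≢z)

  Unique-⊆⇒length≤ : ∀ {xs ys : List A} → Unique xs → (∀ {x} → x ∈ xs → x ∈ ys) → length xs ≤ length ys
  Unique-⊆⇒length≤ {[]} _ _ = z≤n
  Unique-⊆⇒length≤ {x ∷ xs} {ys} (x∉xs ∷ uxs) xs⊆ys =
    subst (suc (length xs) ≤_) (length-remove ys x∈ys)
      (s≤s (Unique-⊆⇒length≤ uxs λ z∈ → ∈-remove ys x∈ys (xs⊆ys (there z∈)) (All.lookup x∉xs z∈)))
    where x∈ys = xs⊆ys (here refl)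

  AllPairs-weaken : ∀ {P : A → Set} {R S : A → A → Set} {xs} →
    (∀ {x y} → P x → P y → R x y → S x y) → All P xs → AllPairs R xs → AllPairs S xs
  AllPairs-weaken R⇒S [] [] = []
  AllPairs-weaken R⇒S (px ∷ pxs) (rx ∷ rxs) =
    All.zipWith (λ (py , r) → R⇒S px py r) (pxs , rx) ∷ AllPairs-weaken R⇒S pxs rxs

module _ {A B : Set} where

  Unique-map-injectiveOn : ∀ (f : A → B) {xs} → Unique xs →
    (∀ {x y} → x ∈ xs → y ∈ xs → f x ≡ f y → x ≡ y) → Unique (map f xs)
  Unique-map-injectiveOn f {xs} uxs inj =
    AllPairs.map⁺ (AllPairs-weaken (λ x∈ y∈ x≢y fx≡fy → x≢y (inj x∈ y∈ fx≡fy)) (All.tabulate λ x∈ → x∈) uxs)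

-- Words with prescribed multiplicities

[r+s]Cr*r!*s!≡[r+s]! : ∀ r s → ((r + s) C r) * (r ! * s !) ≡ (r + s) !
[r+s]Cr*r!*s!≡[r+s]! r s = begin
  ((r + s) C r) * (r ! * s !)                                  ≡⟨ cong (λ t → ((r + s) C r) * (r ! * t !)) (m+n∸m≡n r s) ⟨
  ((r + s) C r) * (r ! * (r + s ∸ r) !)                        ≡⟨ cong (_* (r ! * (r + s ∸ r) !)) (nCk≡n!/k![n-k]! r≤r+s) ⟩
  (r + s) ! / (r ! * (r + s ∸ r) !) * (r ! * (r + s ∸ r) !)  ≡⟨ m/n*n≡m (k![n∸k]!∣n! r≤r+s) ⟩
  (r + s) !                                                  ∎
  where
  open ≡-Reasoning
  r≤r+s : r ≤ r + s
  r≤r+s = m≤m+n r s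
  instance _ = r !* (r + s ∸ r) !≢0

length-concatMap-const : ∀ {A B : Set} (g : A → List B) xs c →
  (∀ {x} → x ∈ xs → length (g x) ≡ c) → length (concatMap g xs) ≡ length xs * c
length-concatMap-const g [] c _ = refl
length-concatMap-const g (x ∷ xs) c len≡c =
  trans (length-++ (g x)) (cong₂ _+_ (len≡c (here refl)) (length-concatMap-const g xs c (len≡c ∘ there)))

module Words {A : Set} (_≟_ : DecidableEquality A) where

  occurrences : A → List A → ℕ
  occurrences a = countᵇ (λ y → ⌊ y ≟ a ⌋)

  occurrences-here : ∀ x w → occurrences x (x ∷ w) ≡ suc (occurrences x w)
  occurrences-here x w rewrite countᵇ-∷ (λ y → ⌊ y ≟ x ⌋) x w | ⌊⌋-true (x ≟ x) refl = refl

  occurrences-there : ∀ {a y} w → y ≢ a → occurrences a (y ∷ w) ≡ occurrences a w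
  occurrences-there {a} {y} w y≢a rewrite countᵇ-∷ (λ z → ⌊ z ≟ a ⌋) y w | ⌊⌋-false (y ≟ a) y≢a = refl

  occurrences-unique : ∀ {a xs} → Unique xs → a ∈ xs → occurrences a xs ≡ 1
  occurrences-unique {a} {a ∷ xs} (a∉xs ∷ _) (here refl) =
    trans (occurrences-here a xs) (cong suc (countᵇ-none _ xs λ y y∈ → ⌊⌋-false (y ≟ a) λ { refl → All.lookup a∉xs y∈ refl }))
  occurrences-unique {a} {y ∷ xs} (y∉xs ∷ uxs) (there a∈xs) =
    trans (occurrences-there xs λ { refl → All.lookup y∉xs a∈xs refl }) (occurrences-unique uxs a∈xs)

  erase : A → List A → List A
  erase a = filterᵇ (λ y → not ⌊ y ≟ a ⌋)

  data Interleaving (x : A) : ℕ → List A → List A → Set where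
    []   : Interleaving x 0 [] []
    take : ∀ {r w z} → Interleaving x r w z → Interleaving x (suc r) w (x ∷ z)
    keep : ∀ {r y w z} → Interleaving x r w z → Interleaving x r (y ∷ w) (y ∷ z)

  module _ {x : A} where

    Interleaving-length : ∀ {r w z} → Interleaving x r w z → length z ≡ r + length w
    Interleaving-length [] = refl
    Interleaving-length (take p) = cong suc (Interleaving-length p)
    Interleaving-length {r} (keep {w = w} p) = trans (cong suc (Interleaving-length p)) (sym (+-suc r (length w)))

    Interleaving-∈ : ∀ {r w z y} → Interleaving x r w z → y ∈ z → y ≡ x ⊎ y ∈ w
    Interleaving-∈ (take p) (here y≡x) = inj₁ y≡x
    Interleaving-∈ (take p) (there y∈z) = Interleaving-∈ p y∈z
    Interleaving-∈ (keep p) (here y≡y′) = inj₂ (here y≡y′)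
    Interleaving-∈ (keep p) (there y∈z) = Data.Sum.map₂ there (Interleaving-∈ p y∈z)

    Interleaving-occurrences-self : ∀ {r w z} → Interleaving x r w z → occurrences x z ≡ r + occurrences x w
    Interleaving-occurrences-self [] = refl
    Interleaving-occurrences-self {z = x ∷ z} (take p) =
      trans (occurrences-here x z) (cong suc (Interleaving-occurrences-self p))
    Interleaving-occurrences-self {r} (keep {y = y} {w} {z} p) = begin
      occurrences x (y ∷ z)            ≡⟨ countᵇ-∷ _ y z ⟩
      b + occurrences x z              ≡⟨ cong (b +_) (Interleaving-occurrences-self p) ⟩
      b + (r + occurrences x w)        ≡⟨ +-CS.x∙yz≈y∙xz b r _ ⟩
      r + (b + occurrences x w)        ≡⟨ cong (r +_) (countᵇ-∷ _ y w) ⟨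
      r + occurrences x (y ∷ w)        ∎
      where
      open ≡-Reasoning
      b = if ⌊ y ≟ x ⌋ then 1 else 0

    Interleaving-occurrences-other : ∀ {a r w z} → x ≢ a → Interleaving x r w z → occurrences a z ≡ occurrences a w
    Interleaving-occurrences-other x≢a [] = refl
    Interleaving-occurrences-other x≢a (take {z = z} p) =
      trans (occurrences-there z x≢a) (Interleaving-occurrences-other x≢a p)
    Interleaving-occurrences-other {a} x≢a (keep {y = y} {w} {z} p) = begin
      occurrences a (y ∷ z)                         ≡⟨ countᵇ-∷ _ y z ⟩
      (if ⌊ y ≟ a ⌋ then 1 else 0) + occurrences a z ≡⟨ cong (_ +_) (Interleaving-occurrences-other x≢a p) ⟩
      (if ⌊ y ≟ a ⌋ then 1 else 0) + occurrences a w ≡⟨ countᵇ-∷ _ y w ⟨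
      occurrences a (y ∷ w)                         ∎
      where open ≡-Reasoning

    Interleaving-erase : ∀ {r w z} → x ∉ w → Interleaving x r w z → erase x z ≡ w
    Interleaving-erase x∉w [] = refl
    Interleaving-erase x∉w (take p) with x ≟ x
    ... | yes _ = Interleaving-erase x∉w p
    ... | no x≢x = contradiction refl x≢x
    Interleaving-erase x∉w (keep {y = y} p) with y ≟ x
    ... | yes refl = contradiction (here refl) x∉w
    ... | no _ = cong (y ∷_) (Interleaving-erase (x∉w ∘ there) p)

  interleavings : A → ℕ → List A → List (List A)
  interleavings x zero w = [ w ]
  interleavings x (suc r) [] = [ replicate (suc r) x ]
  interleavings x (suc r) (y ∷ w) = map (x ∷_) (interleavings x r (y ∷ w)) ++ map (y ∷_) (interleavings x (suc r) w)

  ∈-interleavings⁻ : ∀ x r w {z} → z ∈ interleavings x r w → Interleaving x r w z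
  ∈-interleavings⁻ x zero w (here refl) = keepAll w
    where keepAll : ∀ w → Interleaving x 0 w w
          keepAll [] = []
          keepAll (y ∷ w) = keep (keepAll w)
  ∈-interleavings⁻ x (suc r) [] (here refl) = takeAll (suc r)
    where takeAll : ∀ r → Interleaving x r [] (replicate r x)
          takeAll zero = []
          takeAll (suc r) = take (takeAll r)
  ∈-interleavings⁻ x (suc r) (y ∷ w) z∈ with ∈-++⁻ (map (x ∷_) (interleavings x r (y ∷ w))) z∈
  ... | inj₁ z∈taken with _ , z′∈ , refl ← ∈-map⁻ (x ∷_) z∈taken = take (∈-interleavings⁻ x r (y ∷ w) z′∈)
  ... | inj₂ z∈kept with _ , z′∈ , refl ← ∈-map⁻ (y ∷_) z∈kept = keep (∈-interleavings⁻ x (suc r) w z′∈)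

  length-interleavings : ∀ x r w → length (interleavings x r w) ≡ (r + length w) C r
  length-interleavings x zero w = refl
  length-interleavings x (suc r) [] = sym (trans (cong (_C suc r) (+-identityʳ (suc r))) (nCn≡1 (suc r)))
  length-interleavings x (suc r) (y ∷ w) = begin
    length (map (x ∷_) taken ++ map (y ∷_) kept)          ≡⟨ length-++ (map (x ∷_) taken) ⟩
    length (map (x ∷_) taken) + length (map (y ∷_) kept)  ≡⟨ cong₂ _+_ (length-map (x ∷_) taken) (length-map (y ∷_) kept) ⟩
    length taken + length kept                             ≡⟨ cong₂ _+_ (length-interleavings x r (y ∷ w)) (length-interleavings x (suc r) w) ⟩
    (r + suc s) C r + suc (r + s) C suc r                  ≡⟨ cong (λ t → t C r + suc (r + s) C suc r) (+-suc r s) ⟩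
    suc (r + s) C r + suc (r + s) C suc r                  ≡⟨ nCk+nC[k+1]≡[n+1]C[k+1] (suc (r + s)) r ⟩
    suc (suc (r + s)) C suc r                              ≡⟨ cong (λ t → suc t C suc r) (+-suc r s) ⟨
    (suc r + suc s) C suc r                                ∎
    where
    open ≡-Reasoning
    s = length w
    taken = interleavings x r (y ∷ w)
    kept = interleavings x (suc r) w

  interleavings-unique : ∀ x r w → x ∉ w → Unique (interleavings x r w)
  interleavings-unique x zero w _ = [] ∷ []
  interleavings-unique x (suc r) [] _ = [] ∷ []
  interleavings-unique x (suc r) (y ∷ w) x∉y∷w =
    Unique.++⁺ (Unique.map⁺ ∷-injectiveʳ (interleavings-unique x r (y ∷ w) x∉y∷w))
               (Unique.map⁺ ∷-injectiveʳ (interleavings-unique x (suc r) w (x∉y∷w ∘ there)))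
               disjoint
    where
    disjoint : Disjoint (map (x ∷_) (interleavings x r (y ∷ w))) (map (y ∷_) (interleavings x (suc r) w))
    disjoint (z∈taken , z∈kept) with _ , _ , refl ← ∈-map⁻ _ z∈taken | _ , _ , x∷z≡y∷z′ ← ∈-map⁻ _ z∈kept =
      x∉y∷w (here (proj₁ (∷-injective x∷z≡y∷z′)))

  words : (A → ℕ) → List A → List (List A)
  words f [] = [ [] ]
  words f (a ∷ L) = concatMap (interleavings a (f a)) (words f L)

  ∈-words⁻ : ∀ f a L {z} → z ∈ words f (a ∷ L) → ∃ λ w → w ∈ words f L × Interleaving a (f a) w z
  ∈-words⁻ f a L z∈ with w , w∈ , z∈′ ← find (∈-concatMap⁻ _ z∈) = w , w∈ , ∈-interleavings⁻ a (f a) w z∈′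

  words-⊆ : ∀ {f} L {z y} → z ∈ words f L → y ∈ z → y ∈ L
  words-⊆ [] (here refl) ()
  words-⊆ {f} (a ∷ L) z∈ y∈z with w , w∈ , p ← ∈-words⁻ f a L z∈ with Interleaving-∈ p y∈z
  ... | inj₁ y≡a = here y≡a
  ... | inj₂ y∈w = there (words-⊆ L w∈ y∈w)

  words-length : ∀ {f} L {z} → z ∈ words f L → length z ≡ sum (map f L)
  words-length [] (here refl) = refl
  words-length {f} (a ∷ L) z∈ with w , w∈ , p ← ∈-words⁻ f a L z∈ =
    trans (Interleaving-length p) (cong (f a +_) (words-length L w∈))

  words-occurrences : ∀ {f L z a} → Unique L → z ∈ words f L → a ∈ L → occurrences a z ≡ f a
  words-occurrences {f} {a ∷ L} {z} (a∉L ∷ uL) z∈ a′∈ with w , w∈ , p ← ∈-words⁻ f a L z∈ | a′∈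
  ... | here refl = trans (Interleaving-occurrences-self p)
                          (trans (cong (f a +_) (countᵇ-none _ w no-a)) (+-identityʳ (f a)))
    where no-a : ∀ y → y ∈ w → ⌊ y ≟ a ⌋ ≡ false
          no-a y y∈w = ⌊⌋-false (y ≟ a) λ { refl → All.lookup a∉L (words-⊆ L w∈ y∈w) refl }
  ... | there a′∈L = trans (Interleaving-occurrences-other (λ { refl → All.lookup a∉L a′∈L refl }) p)
                           (words-occurrences uL w∈ a′∈L)

  words-unique : ∀ f {L} → Unique L → Unique (words f L)
  words-unique f {[]} _ = [] ∷ []
  words-unique f {a ∷ L} (a∉L ∷ uL) =
    Unique.concat⁺ (All.map⁺ (All.tabulate λ w∈ → interleavings-unique a (f a) _ (a∉ w∈)))
                   (AllPairs.map⁺ (AllPairs-weaken disjoint (All.tabulate λ w∈ → w∈) (words-unique f uL)))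
    where
    a∉ : ∀ {w} → w ∈ words f L → a ∉ w
    a∉ w∈ a∈w = All.lookup a∉L (words-⊆ L w∈ a∈w) refl
    disjoint : ∀ {w₁ w₂} → w₁ ∈ words f L → w₂ ∈ words f L → w₁ ≢ w₂ →
               Disjoint (interleavings a (f a) w₁) (interleavings a (f a) w₂)
    disjoint w₁∈ w₂∈ w₁≢w₂ (z∈₁ , z∈₂) =
      w₁≢w₂ (trans (sym (Interleaving-erase (a∉ w₁∈) (∈-interleavings⁻ a (f a) _ z∈₁)))
                   (Interleaving-erase (a∉ w₂∈) (∈-interleavings⁻ a (f a) _ z∈₂)))

  length-words : ∀ f L → length (words f L) * product (map _! (map f L)) ≡ sum (map f L) !
  length-words f [] = refl
  length-words f (a ∷ L) = begin
    length (concatMap (interleavings a (f a)) (words f L)) * (f a ! * P)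
      ≡⟨ cong (_* (f a ! * P)) (length-concatMap-const _ (words f L) _ length-each) ⟩
    length (words f L) * ((f a + s) C f a) * (f a ! * P)
      ≡⟨ rearrange (length (words f L)) ((f a + s) C f a) (f a !) P ⟩
    ((f a + s) C f a) * (f a ! * (length (words f L) * P))
      ≡⟨ cong (λ t → ((f a + s) C f a) * (f a ! * t)) (length-words f L) ⟩
    ((f a + s) C f a) * (f a ! * s !)
      ≡⟨ [r+s]Cr*r!*s!≡[r+s]! (f a) s ⟩
    (f a + s) ! ∎
    where
    open ≡-Reasoning
    P = product (map _! (map f L))
    s = sum (map f L)
    length-each : ∀ {w} → w ∈ words f L → length (interleavings a (f a) w) ≡ (f a + s) C f a
    length-each {w} w∈ = trans (length-interleavings a (f a) w) (cong (λ t → (f a + t) C f a) (words-length L w∈))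
    rearrange : ∀ l c m p → l * c * (m * p) ≡ c * (m * (l * p))
    rearrange = solve-∀

module _ {B : Set} where

  choices : ∀ n → (Fin n → List B) → List (Vec B n)
  choices zero F = [ [] ]
  choices (suc n) F = cartesianProductWith _∷_ (F zero) (choices n (F ∘ suc))

  length-cartesianProductWith : ∀ {C D : Set} (f : B → D → C) xs ys →
    length (cartesianProductWith f xs ys) ≡ length xs * length ys
  length-cartesianProductWith f [] ys = refl
  length-cartesianProductWith f (x ∷ xs) ys =
    trans (length-++ (map (f x) ys)) (cong₂ _+_ (length-map (f x) ys) (length-cartesianProductWith f xs ys))

  length-choices : ∀ n (F : Fin n → List B) → length (choices n F) ≡ product (tabulate (length ∘ F))
  length-choices zero F = refl
  length-choices (suc n) F =
    trans (length-cartesianProductWith _∷_ (F zero) (choices n (F ∘ suc)))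
          (cong (length (F zero) *_) (length-choices n (F ∘ suc)))

  choices-unique : ∀ n (F : Fin n → List B) → (∀ v → Unique (F v)) → Unique (choices n F)
  choices-unique zero F _ = [] ∷ []
  choices-unique (suc n) F uF =
    Unique.cartesianProductWith⁺ _∷_ Vec.∷-injective (uF zero) (choices-unique n (F ∘ suc) (uF ∘ suc))

  ∈-choices⁻ : ∀ n (F : Fin n → List B) {σ} → σ ∈ choices n F → ∀ v → lookup σ v ∈ F v
  ∈-choices⁻ (suc n) F σ∈ v with ∈-cartesianProductWith⁻ _∷_ (F zero) (choices n (F ∘ suc)) σ∈
  ∈-choices⁻ (suc n) F σ∈ zero | _ , _ , x∈ , _ , refl = x∈
  ∈-choices⁻ (suc n) F σ∈ (suc v) | _ , _ , _ , σ′∈ , refl = ∈-choices⁻ n (F ∘ suc) σ′∈ v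

  lookup-extensionality : ∀ {n} {σ τ : Vec B n} → (∀ v → lookup σ v ≡ lookup τ v) → σ ≡ τ
  lookup-extensionality {σ = σ} {τ} σ≗τ =
    trans (sym (Vec.tabulate∘lookup σ)) (trans (Vec.tabulate-cong σ≗τ) (Vec.tabulate∘lookup τ))

-- Following queues of darts

module Runs (G : Graph) where

  Vertex : Set
  Vertex = Fin (n G)

  Queues : Set
  Queues = Vector (List (Dart G)) (n G)

  Outgoing : Queues → Set
  Outgoing Q = ∀ v {d} → d ∈ Q v → dtail G d ≡ v

  record Run : Set where
    constructor run
    field
      trail    : List (Dart G)
      leftover : Queues
      end      : Vertex
  open Run public

  _◁_ : Dart G → Run → Run
  d ◁ r = run (d ∷ trail r) (leftover r) (end r)

  follow : ℕ → Queues → Vertex → Run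
  follow zero Q c = run [] Q c
  follow (suc f) Q c with Q c
  ... | [] = run [] Q c
  ... | d ∷ ds = d ◁ follow f (updateAt Q c (const ds)) (dhead G d)

  Outgoing-updateAt : ∀ {Q c d ds} → Outgoing Q → Q c ≡ d ∷ ds → Outgoing (updateAt Q c (const ds))
  Outgoing-updateAt {Q} {c} {d} {ds} out Qc≡ v {e} e∈ with v ≟F c
  ... | yes refl = out v (subst (e ∈_) (sym Qc≡) (there (subst (e ∈_) (updateAt-updates v Q) e∈)))
  ... | no v≢c = out v (subst (e ∈_) (updateAt-minimal v c Q v≢c) e∈)

  data Walk : Vertex → List (Dart G) → Vertex → Set where
    []  : ∀ {s} → Walk s [] s
    _∷_ : ∀ {s d ds t} → dtail G d ≡ s → Walk (dhead G d) ds t → Walk s (d ∷ ds) t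

  follow-walk : ∀ f Q c → Outgoing Q → Walk c (trail (follow f Q c)) (end (follow f Q c))
  follow-walk zero Q c out = []
  follow-walk (suc f) Q c out with Q c in Qc≡
  ... | [] = []
  ... | d ∷ ds = out c (subst (d ∈_) (sym Qc≡) (here refl))
               ∷ follow-walk f _ (dhead G d) (Outgoing-updateAt out Qc≡)

  leavingFrom : Vertex → List (Dart G) → List (Dart G)
  leavingFrom v = filterᵇ (λ d → ⌊ dtail G d ≟F v ⌋)

  follow-splits : ∀ f Q c → Outgoing Q → ∀ v →
    leavingFrom v (trail (follow f Q c)) ++ leftover (follow f Q c) v ≡ Q v
  follow-splits zero Q c out v = refl
  follow-splits (suc f) Q c out v with Q c in Qc≡
  ... | [] = refl
  ... | d ∷ ds = split-step (v ≟F c) (follow-splits f Q′ (dhead G d) (Outgoing-updateAt out Qc≡) v)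
    where
    open ≡-Reasoning
    Q′ = updateAt Q c (const ds)
    T = trail (follow f Q′ (dhead G d))
    R = leftover (follow f Q′ (dhead G d))
    d-leaves-c : dtail G d ≡ c
    d-leaves-c = out c (subst (d ∈_) (sym Qc≡) (here refl))
    split-step : Dec (v ≡ c) → leavingFrom v T ++ R v ≡ Q′ v → leavingFrom v (d ∷ T) ++ R v ≡ Q v
    split-step (yes v≡c) ih = begin
      leavingFrom v (d ∷ T) ++ R v  ≡⟨ cong (_++ R v) (filterᵇ-accept d T (⌊⌋-true (dtail G d ≟F v) (trans d-leaves-c (sym v≡c)))) ⟩
      d ∷ (leavingFrom v T ++ R v)  ≡⟨ cong (d ∷_) ih ⟩
      d ∷ Q′ v                      ≡⟨ cong (d ∷_) (trans (cong Q′ v≡c) (updateAt-updates c Q)) ⟩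
      d ∷ ds                        ≡⟨ trans (cong Q v≡c) Qc≡ ⟨
      Q v                           ∎
    split-step (no v≢c) ih = begin
      leavingFrom v (d ∷ T) ++ R v
        ≡⟨ cong (_++ R v) (filterᵇ-reject d T (⌊⌋-false (dtail G d ≟F v) λ d-leaves-v → v≢c (trans (sym d-leaves-v) d-leaves-c))) ⟩
      leavingFrom v T ++ R v        ≡⟨ ih ⟩
      Q′ v                          ≡⟨ updateAt-minimal v c Q v≢c ⟩
      Q v                           ∎

  follow-halts : ∀ f Q c → leftover (follow f Q c) (end (follow f Q c)) ≡ [] ⊎ length (trail (follow f Q c)) ≡ f
  follow-halts zero Q c = inj₂ refl
  follow-halts (suc f) Q c with Q c in Qc≡
  ... | [] = inj₁ Qc≡
  ... | d ∷ ds = Data.Sum.map₂ (cong suc) (follow-halts f _ (dhead G d))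

  Walk⇒isWalkᵇ : ∀ {s L t} → Walk s L t → isWalkᵇ G t s L ≡ true
  Walk⇒isWalkᵇ {s} [] = ⌊⌋-true (s ≟F s) refl
  Walk⇒isWalkᵇ {s} (d-leaves-s ∷ w) rewrite ⌊⌋-true (_ ≟F s) d-leaves-s = Walk⇒isWalkᵇ w

  ∈-allDarts : ∀ d → d ∈ allDarts G
  ∈-allDarts (i , true) = ∈-concatMap⁺ (λ j → (j , true) ∷ (j , false) ∷ []) (Any.map (λ { refl → here refl }) (∈-allFin i))
  ∈-allDarts (i , false) = ∈-concatMap⁺ (λ j → (j , true) ∷ (j , false) ∷ []) (Any.map (λ { refl → there (here refl) }) (∈-allFin i))

  ∈-seqs : ∀ ds → ds ∈ seqs G (length ds)
  ∈-seqs [] = here refl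
  ∈-seqs (d ∷ ds) = ∈-concatMap⁺ (λ e → map (e ∷_) (seqs G (length ds)))
                                 (Any.map (λ { refl → ∈-map⁺ (d ∷_) (∈-seqs ds) }) (∈-allDarts d))

  indeg outdeg : Vertex → List (Dart G) → ℕ
  indeg x = countᵇ (λ d → ⌊ dhead G d ≟F x ⌋)
  outdeg x = countᵇ (λ d → ⌊ dtail G d ≟F x ⌋)

  δ : Vertex → Vertex → ℕ
  δ v x = if ⌊ v ≟F x ⌋ then 1 else 0

  Walk-degrees : ∀ {s L t} → Walk s L t → ∀ x → indeg x L + δ s x ≡ outdeg x L + δ t x
  Walk-degrees [] x = refl
  Walk-degrees {s} (_∷_ {d = d} {ds} {t} refl w) x = begin
    indeg x (d ∷ ds) + δ s x                ≡⟨ cong (_+ δ s x) (countᵇ-∷ _ d ds) ⟩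
    δ (dhead G d) x + indeg x ds + δ s x    ≡⟨ +-CS.xy∙z≈z∙yx (δ (dhead G d) x) (indeg x ds) (δ s x) ⟩
    δ s x + (indeg x ds + δ (dhead G d) x)  ≡⟨ cong (δ s x +_) (Walk-degrees w x) ⟩
    δ s x + (outdeg x ds + δ t x)           ≡⟨ +-assoc (δ s x) (outdeg x ds) (δ t x) ⟨
    δ s x + outdeg x ds + δ t x             ≡⟨ cong (_+ δ t x) (countᵇ-∷ _ d ds) ⟨
    outdeg x (d ∷ ds) + δ t x               ∎
    where open ≡-Reasoning

  byEdge : (Dart G → Bool) → List (Dart G) → Fin (m G) → ℕ
  byEdge P L i = (if P (i , true) then countDart G (i , true) L else 0)
               + (if P (i , false) then countDart G (i , false) L else 0)

  private
    if-+ : ∀ b x y → (if b then x + y else 0) ≡ (if b then x else 0) + (if b then y else 0)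
    if-+ true x y = refl
    if-+ false x y = refl

    if-0 : ∀ b → (if b then 0 else 0) ≡ 0
    if-0 true = refl
    if-0 false = refl

  byEdge-∷ : ∀ P d L i → byEdge P (d ∷ L) i ≡ byEdge P [ d ] i + byEdge P L i
  byEdge-∷ P d L i = begin
    (if P (i , true) then c (i , true) (d ∷ L) else 0) + (if P (i , false) then c (i , false) (d ∷ L) else 0)
      ≡⟨ cong₂ _+_ (cong (λ t → if P (i , true) then t else 0) (countᵇ-++ _ [ d ] L))
                   (cong (λ t → if P (i , false) then t else 0) (countᵇ-++ _ [ d ] L)) ⟩
    (if P (i , true) then c (i , true) [ d ] + c (i , true) L else 0)
      + (if P (i , false) then c (i , false) [ d ] + c (i , false) L else 0)
      ≡⟨ cong₂ _+_ (if-+ (P (i , true)) _ _) (if-+ (P (i , false)) _ _) ⟩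
    ((if P (i , true) then c (i , true) [ d ] else 0) + (if P (i , true) then c (i , true) L else 0))
      + ((if P (i , false) then c (i , false) [ d ] else 0) + (if P (i , false) then c (i , false) L else 0))
      ≡⟨ +-CS.interchange (if P (i , true) then c (i , true) [ d ] else 0) _ (if P (i , false) then c (i , false) [ d ] else 0) _ ⟩
    byEdge P [ d ] i + byEdge P L i ∎
    where
    open ≡-Reasoning
    c = countDart G

  countᵇ-singleton-byEdge : ∀ P d → countᵇ P [ d ] ≡ ∑ (byEdge P [ d ])
  countᵇ-singleton-byEdge P (j , b) = sym (trans (∑-single _ j elsewhere) (at-j b))
    where
    elsewhere : ∀ i → i ≢ j → byEdge P [ (j , b) ] i ≡ 0
    elsewhere i i≢j rewrite ⌊⌋-false (j ≟F i) (i≢j ∘ sym) = cong₂ _+_ (if-0 (P (i , true))) (if-0 (P (i , false)))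
    at-j : ∀ c → byEdge P [ (j , c) ] j ≡ countᵇ P [ (j , c) ]
    at-j c rewrite countᵇ-∷ P (j , c) []
                 | countᵇ-∷ (λ e → _≟D_ {G} e (j , true)) (j , c) []
                 | countᵇ-∷ (λ e → _≟D_ {G} e (j , false)) (j , c) []
                 | ⌊⌋-true (j ≟F j) refl
                 with c
    ... | true with P (j , true)
    ...   | true = cong suc (if-0 (P (j , false)))
    ...   | false = if-0 (P (j , false))
    at-j c | false with P (j , false)
    ...   | true = cong (_+ 1) (if-0 (P (j , true)))
    ...   | false = cong (_+ 0) (if-0 (P (j , true)))

  countᵇ-byEdge : ∀ P L → countᵇ P L ≡ ∑ (byEdge P L)
  countᵇ-byEdge P [] = sym (trans (∑-cong λ i → cong₂ _+_ (if-0 (P (i , true))) (if-0 (P (i , false)))) (∑-zero (m G)))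
  countᵇ-byEdge P (d ∷ L) = begin
    countᵇ P ([ d ] ++ L)                          ≡⟨ countᵇ-++ P [ d ] L ⟩
    countᵇ P [ d ] + countᵇ P L                    ≡⟨ cong₂ _+_ (countᵇ-singleton-byEdge P d) (countᵇ-byEdge P L) ⟩
    ∑ (byEdge P [ d ]) + ∑ (byEdge P L)            ≡⟨ ∑-distrib-+ (byEdge P [ d ]) (byEdge P L) ⟨
    ∑ (λ i → byEdge P [ d ] i + byEdge P L i)      ≡⟨ ∑-cong (λ i → byEdge-∷ P d L i) ⟨
    ∑ (byEdge P (d ∷ L))                           ∎
    where open ≡-Reasoning

  reverse : Dart G → Dart G
  reverse (i , b) = (i , not b)

  dtail-reverse : ∀ d → dtail G (reverse d) ≡ dhead G d
  dtail-reverse (i , true) = refl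
  dtail-reverse (i , false) = refl

  ≟D-refl : ∀ d → _≟D_ {G} d d ≡ true
  ≟D-refl (i , true) rewrite ⌊⌋-true (i ≟F i) refl = refl
  ≟D-refl (i , false) rewrite ⌊⌋-true (i ≟F i) refl = refl

  ≟D-sound : ∀ e d → _≟D_ {G} e d ≡ true → e ≡ d
  ≟D-sound (i , b) (j , c) eq with i ≟F j | b ≟B c
  ... | yes refl | yes refl = refl

  private
    guarded-≤ : ∀ b {x y} → (b ≡ true → x ≤ y) → (if b then x else 0) ≤ (if b then y else 0)
    guarded-≤ true x≤y = x≤y refl
    guarded-≤ false _ = z≤n

    guarded-< : ∀ {b x y} → b ≡ true → x < y → (if b then x else 0) < (if b then y else 0)
    guarded-< refl x<y = x<y

  module Exhaustion (k : Fin (m G) → ℕ) (u : Vertex) (Q : Queues) (out : Outgoing Q)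
    (sized : ∀ d → countDart G d (Q (dtail G d)) ≡ k (proj₁ d))
    (depth : Vertex → ℕ)
    (parent-last : ∀ v → v ≡ u ⊎ ∃ λ p → dtail G p ≡ v × depth (dhead G p) < depth v × ∃ λ xs → Q v ≡ xs ++ [ p ])
    where

    fuel : ℕ
    fuel = ∑ (λ i → k i + k i)

    T : List (Dart G)
    T = trail (follow fuel Q u)

    R : Queues
    R = leftover (follow fuel Q u)

    final : Vertex
    final = end (follow fuel Q u)

    uses : Dart G → ℕ
    uses d = countDart G d T

    splits : ∀ v → leavingFrom v T ++ R v ≡ Q v
    splits = follow-splits fuel Q u out

    used+left : ∀ d → uses d + countDart G d (R (dtail G d)) ≡ k (proj₁ d)
    used+left d = begin
      uses d + countDart G d (R v)                       ≡⟨ cong (_+ countDart G d (R v)) (countᵇ-filterᵇ _ _ T same-tail) ⟨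
      countDart G d (leavingFrom v T) + countDart G d (R v) ≡⟨ countᵇ-++ _ (leavingFrom v T) (R v) ⟨
      countDart G d (leavingFrom v T ++ R v)             ≡⟨ cong (countDart G d) (splits v) ⟩
      countDart G d (Q v)                                ≡⟨ sized d ⟩
      k (proj₁ d)                                        ∎
      where
      open ≡-Reasoning
      v = dtail G d
      same-tail : ∀ d′ → _≟D_ {G} d′ d ≡ true → ⌊ dtail G d′ ≟F v ⌋ ≡ true
      same-tail d′ d′≡d = ⌊⌋-true (dtail G d′ ≟F v) (cong (dtail G) (≟D-sound d′ d d′≡d))

    used≤ : ∀ d → uses d ≤ k (proj₁ d)
    used≤ d = subst (uses d ≤_) (used+left d) (m≤m+n _ _)

    Exhausted : Vertex → Set
    Exhausted v = R v ≡ []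

    exhausted⇒used : ∀ {v} → Exhausted v → ∀ d → dtail G d ≡ v → uses d ≡ k (proj₁ d)
    exhausted⇒used ex d refl =
      trans (sym (+-identityʳ _)) (trans (cong (λ l → uses d + countDart G d l) (sym ex)) (used+left d))

    left⇒unused : ∀ {v d} → d ∈ R v → uses d < k (proj₁ d)
    left⇒unused {v} {d} d∈ with refl ← out v (subst (d ∈_) (splits v) (∈-++⁺ʳ _ d∈)) =
      subst (uses d <_) (used+left d) (m<m+n (uses d) (countᵇ-pos _ _ d∈ (≟D-refl d)))

    entering≤reverse : ∀ {x} → Exhausted x → ∀ d → dhead G d ≡ x → uses d ≤ uses (reverse d)
    entering≤reverse ex d d-enters-x =
      subst (uses d ≤_) (sym (exhausted⇒used ex (reverse d) (trans (dtail-reverse d) d-enters-x))) (used≤ d)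

    entering<reverse : ∀ {x} → Exhausted x → ∀ d → dhead G d ≡ x → uses d < k (proj₁ d) → uses d < uses (reverse d)
    entering<reverse ex d d-enters-x d-unused =
      subst (uses d <_) (sym (exhausted⇒used ex (reverse d) (trans (dtail-reverse d) d-enters-x))) d-unused

    enters leaves : Vertex → Dart G → Bool
    enters x d = ⌊ dhead G d ≟F x ⌋
    leaves x d = ⌊ dtail G d ≟F x ⌋

    guarded-in≤out : ∀ {x} → Exhausted x → ∀ d →
      (if enters x d then uses d else 0) ≤ (if leaves x (reverse d) then uses (reverse d) else 0)
    guarded-in≤out {x} ex d rewrite dtail-reverse d =
      guarded-≤ (enters x d) λ h → entering≤reverse ex d (⌊⌋-sound (dhead G d ≟F x) h)

    guarded-in<out : ∀ {x} → Exhausted x → ∀ d → dhead G d ≡ x → uses d < k (proj₁ d) →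
      (if enters x d then uses d else 0) < (if leaves x (reverse d) then uses (reverse d) else 0)
    guarded-in<out {x} ex d d-enters-x d-unused rewrite dtail-reverse d =
      guarded-< (⌊⌋-true (dhead G d ≟F x) d-enters-x) (entering<reverse ex d d-enters-x d-unused)

    byEdge-out-swapped : ∀ x i → byEdge (leaves x) T i ≡
      (if leaves x (reverse (i , true)) then uses (reverse (i , true)) else 0)
      + (if leaves x (reverse (i , false)) then uses (reverse (i , false)) else 0)
    byEdge-out-swapped x i = +-comm (if leaves x (i , true) then uses (i , true) else 0) _

    byEdge-in≤out : ∀ {x} → Exhausted x → ∀ i → byEdge (enters x) T i ≤ byEdge (leaves x) T i
    byEdge-in≤out {x} ex i = subst (byEdge (enters x) T i ≤_) (sym (byEdge-out-swapped x i))
      (+-mono-≤ (guarded-in≤out ex (i , true)) (guarded-in≤out ex (i , false)))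

    byEdge-in<out : ∀ {x} → Exhausted x → ∀ p → dhead G p ≡ x → uses p < k (proj₁ p) →
      byEdge (enters x) T (proj₁ p) < byEdge (leaves x) T (proj₁ p)
    byEdge-in<out {x} ex (i , true) p-enters-x p-unused = subst (byEdge (enters x) T i <_) (sym (byEdge-out-swapped x i))
      (+-mono-<-≤ (guarded-in<out ex (i , true) p-enters-x p-unused) (guarded-in≤out ex (i , false)))
    byEdge-in<out {x} ex (i , false) p-enters-x p-unused = subst (byEdge (enters x) T i <_) (sym (byEdge-out-swapped x i))
      (+-mono-≤-< (guarded-in≤out ex (i , true)) (guarded-in<out ex (i , false) p-enters-x p-unused))

    in≤out : ∀ {x} → Exhausted x → indeg x T ≤ outdeg x T
    in≤out {x} ex = subst₂ _≤_ (sym (countᵇ-byEdge (enters x) T)) (sym (countᵇ-byEdge (leaves x) T)) (∑-mono-≤ (byEdge-in≤out ex))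

    in<out : ∀ {x} → Exhausted x → ∀ p → dhead G p ≡ x → uses p < k (proj₁ p) → indeg x T < outdeg x T
    in<out {x} ex p p-enters-x p-unused = subst₂ _<_ (sym (countᵇ-byEdge (enters x) T)) (sym (countᵇ-byEdge (leaves x) T))
      (∑-mono-< (byEdge-in≤out ex) (proj₁ p) (byEdge-in<out ex p p-enters-x p-unused))

    length-by-edge : length T ≡ ∑ (λ i → uses (i , true) + uses (i , false))
    length-by-edge = trans (sym (countᵇ-true T)) (countᵇ-byEdge (λ _ → true) T)

    both-used : length T ≡ fuel → ∀ i → uses (i , true) + uses (i , false) ≡ k i + k i
    both-used full = ∑-≤-≡⇒≡ (λ i → +-mono-≤ (used≤ (i , true)) (used≤ (i , false))) (trans (sym length-by-edge) full)

    full⇒all-used : length T ≡ fuel → ∀ d → uses d ≡ k (proj₁ d)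
    full⇒all-used full (i , true) =
      m≤o⇒n≤o⇒m+n≡o+o⇒m≡o (used≤ (i , true)) (used≤ (i , false)) (both-used full i)
    full⇒all-used full (i , false) =
      m≤o⇒n≤o⇒m+n≡o+o⇒m≡o (used≤ (i , false)) (used≤ (i , true)) (trans (+-comm (uses (i , false)) _) (both-used full i))

    -- Either the walk got stuck, or it used all 2 Σ k darts and so emptied every queue.
    end-exhausted : Exhausted final
    end-exhausted with follow-halts fuel Q u
    ... | inj₁ ex = ex
    ... | inj₂ full = ∉-all⇒[] (R final) λ d∈ → <-irrefl (full⇒all-used full _) (left⇒unused d∈)

    walk : Walk u T final
    walk = follow-walk fuel Q u out

    returns : final ≡ u
    returns with u ≟F final
    ... | yes u≡final = sym u≡final
    ... | no u≢final = contradiction (in≤out end-exhausted) (<⇒≱ out<in)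
      where
      out<in : outdeg final T < indeg final T
      out<in = begin-strict
        outdeg final T                  <⟨ m<m+n (outdeg final T) z<s ⟩
        outdeg final T + 1              ≡⟨ cong (λ b → outdeg final T + (if b then 1 else 0)) (⌊⌋-true (final ≟F final) refl) ⟨
        outdeg final T + δ final final  ≡⟨ Walk-degrees walk final ⟨
        indeg final T + δ u final       ≡⟨ cong (λ b → indeg final T + (if b then 1 else 0)) (⌊⌋-false (u ≟F final) u≢final) ⟩
        indeg final T + 0               ≡⟨ +-identityʳ (indeg final T) ⟩
        indeg final T                   ∎
        where open ≤-Reasoning

    closed : Walk u T u
    closed = subst (Walk u T) returns walk

    balanced : ∀ x → indeg x T ≡ outdeg x T
    balanced x = +-cancelʳ-≡ (δ u x) (indeg x T) (outdeg x T) (Walk-degrees closed x)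

    -- If v's queue were not emptied, its last dart p, towards the shallower w, would be unused.
    exhausted-below : ∀ b v → depth v < b → Exhausted v
    exhausted-below (suc b) v depth<b with parent-last v
    ... | inj₁ refl = subst Exhausted returns end-exhausted
    ... | inj₂ (p , refl , shallower , xs , Qv≡xs∷p) with R v in Rv≡
    ...   | [] = refl
    ...   | d ∷ ds = contradiction (balanced w) (<⇒≢ (in<out w-exhausted p refl p-unused))
      where
      w = dhead G p
      w-exhausted : Exhausted w
      w-exhausted = exhausted-below b w (≤-trans shallower (≤-pred depth<b))
      p-unused : uses p < k (proj₁ p)
      p-unused = left⇒unused (last-∈-suffix (leavingFrom v T) (R v) xs (trans (splits v) Qv≡xs∷p)
                   λ Rv≡[] → contradiction (trans (sym Rv≡) Rv≡[]) λ ())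

    exhausted : ∀ v → Exhausted v
    exhausted v = exhausted-below (suc (depth v)) v ≤-refl

    all-used : ∀ d → uses d ≡ k (proj₁ d)
    all-used d = exhausted⇒used (exhausted (dtail G d)) d refl

    leavingFrom-tour : ∀ v → leavingFrom v T ≡ Q v
    leavingFrom-tour v = begin
      leavingFrom v T         ≡⟨ ++-identityʳ (leavingFrom v T) ⟨
      leavingFrom v T ++ []   ≡⟨ cong (leavingFrom v T ++_) (exhausted v) ⟨
      leavingFrom v T ++ R v  ≡⟨ splits v ⟩
      Q v                     ∎
      where open ≡-Reasoning

    length-tour : length T ≡ fuel
    length-tour = trans length-by-edge (∑-cong λ i → cong₂ _+_ (all-used (i , true)) (all-used (i , false)))

-- Arrangements and their tours

module Arrangements (G : Graph) (conn : Connected G) (k : Fin (m G) → ℕ) (k>0 : ∀ i → k i > 0) (u : Fin (n G)) where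

  open Runs G
  open Words (_≟F_ {m G})

  isIncident : Vertex → Fin (m G) → Bool
  isIncident v i = ⌊ src G i ≟F v ⌋ ∨ ⌊ tgt G i ≟F v ⌋

  outDart : Vertex → Fin (m G) → Dart G
  outDart v i = (i , ⌊ src G i ≟F v ⌋)

  outDart-tail : ∀ {v i} → isIncident v i ≡ true → dtail G (outDart v i) ≡ v
  outDart-tail {v} {i} _ with src G i ≟F v | tgt G i ≟F v
  ... | yes src≡v | _ = src≡v
  ... | no _ | yes tgt≡v = tgt≡v

  outDart-dtail : ∀ d → outDart (dtail G d) (proj₁ d) ≡ d
  outDart-dtail (i , true) rewrite ⌊⌋-true (src G i ≟F src G i) refl = refl
  outDart-dtail (i , false) rewrite ⌊⌋-false (src G i ≟F tgt G i) (noLoop G i) = refl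

  isIncident-dtail : ∀ d → isIncident (dtail G d) (proj₁ d) ≡ true
  isIncident-dtail (i , true) rewrite ⌊⌋-true (src G i ≟F src G i) refl = refl
  isIncident-dtail (i , false) rewrite ⌊⌋-true (tgt G i ≟F tgt G i) refl = ∨-zeroʳ _

  Adj⇒outDart : ∀ {v w} → Adj G v w → ∃ λ i → isIncident v i ≡ true × dhead G (outDart v i) ≡ w
  Adj⇒outDart (i , inj₁ (refl , refl)) = i , isIncident-dtail (i , true) , cong (dhead G) (outDart-dtail (i , true))
  Adj⇒outDart (i , inj₂ (refl , refl)) = i , isIncident-dtail (i , false) , cong (dhead G) (outDart-dtail (i , false))

  Near : ℕ → Vertex → Set
  Near zero v = v ≡ u
  Near (suc t) v = Near t v ⊎ ∃ λ i → isIncident v i ≡ true × Near t (dhead G (outDart v i))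

  near? : ∀ t v → Dec (Near t v)
  near? zero v = v ≟F u
  near? (suc t) v = near? t v ⊎-dec any? λ i → (isIncident v i ≟B true) ×-dec near? t (dhead G (outDart v i))

  Reach⇒Near : ∀ {v} → Reach G v u → ∃ λ t → Near t v
  Reach⇒Near here = 0 , refl
  Reach⇒Near (step adj r) with t , near ← Reach⇒Near r | i , inc , head≡w ← Adj⇒outDart adj =
    suc t , inj₂ (i , inc , subst (Near t) (sym head≡w) near)

  nearest : ∀ v → ∃ λ t → Near t v × (∀ {s} → Near s v → t ≤ s)
  nearest v = least (λ t → near? t v) (proj₂ (Reach⇒Near (conn v u)))

  depth : Vertex → ℕ
  depth v = proj₁ (nearest v)

  Parent : Vertex → Set
  Parent v = ∃ λ i → isIncident v i ≡ true × depth (dhead G (outDart v i)) < depth v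

  root-or-parent : ∀ v → v ≡ u ⊎ Parent v
  root-or-parent v = classify (depth v) (proj₁ (proj₂ (nearest v))) (proj₂ (proj₂ (nearest v)))
    where
    classify : ∀ t → Near t v → (∀ {s} → Near s v → t ≤ s) →
               v ≡ u ⊎ ∃ λ i → isIncident v i ≡ true × depth (dhead G (outDart v i)) < t
    classify zero v≡u _ = inj₁ v≡u
    classify (suc t) (inj₁ near) minimal = contradiction (minimal near) 1+n≰n
    classify (suc t) (inj₂ (i , inc , near)) _ = inj₂ (i , inc , s≤s (proj₂ (proj₂ (nearest _)) near))

  exitOrder : ∀ v → v ≡ u ⊎ Parent v → List (Fin (m G))
  exitOrder v (inj₁ _) = incident G v
  exitOrder v (inj₂ (i , _)) = filterᵇ (λ j → not ⌊ j ≟F i ⌋) (incident G v) ++ [ i ]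

  incident-unique : ∀ v → Unique (incident G v)
  incident-unique v = Unique.filter⁺ _ (Unique.allFin⁺ (m G))

  ∈-incident⁻ : ∀ {v j} → j ∈ incident G v → isIncident v j ≡ true
  ∈-incident⁻ j∈ = proj₂ (∈-filterᵇ⁻ (allFin _) j∈)

  ∈-incident⁺ : ∀ {v j} → isIncident v j ≡ true → j ∈ incident G v
  ∈-incident⁺ {j = j} inc = ∈-filterᵇ⁺ (∈-allFin j) inc

  exitOrder-incident : ∀ v p {j} → j ∈ exitOrder v p → isIncident v j ≡ true
  exitOrder-incident v (inj₁ _) j∈ = ∈-incident⁻ j∈
  exitOrder-incident v (inj₂ (i , inc , _)) j∈ with ∈-++⁻ (filterᵇ (λ j → not ⌊ j ≟F i ⌋) (incident G v)) j∈
  ... | inj₁ j∈others = ∈-incident⁻ (proj₁ (∈-filterᵇ⁻ (incident G v) j∈others))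
  ... | inj₂ (here refl) = inc

  exitOrder-unique : ∀ v p → Unique (exitOrder v p)
  exitOrder-unique v (inj₁ _) = incident-unique v
  exitOrder-unique v (inj₂ (i , _)) =
    Unique.++⁺ (Unique.filter⁺ _ (incident-unique v)) ([] ∷ [])
      λ { (i∈others , here refl) → contradiction (trans (sym (proj₂ (∈-filterᵇ⁻ (incident G v) i∈others)))
                                                        (cong not (⌊⌋-true (i ≟F i) refl))) λ () }

  ∈-exitOrder : ∀ v p {j} → isIncident v j ≡ true → j ∈ exitOrder v p
  ∈-exitOrder v (inj₁ _) inc = ∈-incident⁺ inc
  ∈-exitOrder v (inj₂ (i , _)) {j} inc with j ≟F i
  ... | yes refl = ∈-++⁺ʳ _ (here refl)
  ... | no j≢i = ∈-++⁺ˡ (∈-filterᵇ⁺ (∈-incident⁺ inc) (cong not (⌊⌋-false (j ≟F i) j≢i)))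

  exitOrder-last : ∀ v p (w : List (Fin (m G))) → v ≡ u ⊎ ∃ λ pd → dtail G pd ≡ v ×
    depth (dhead G pd) < depth v × ∃ λ xs → map (outDart v) (w ++ exitOrder v p) ≡ xs ++ [ pd ]
  exitOrder-last v (inj₁ v≡u) w = inj₁ v≡u
  exitOrder-last v (inj₂ (i , inc , shallower)) w =
    inj₂ (outDart v i , outDart-tail inc , shallower , map (outDart v) (w ++ others) ,
          trans (cong (map (outDart v)) (sym (++-assoc w others [ i ]))) (map-++ (outDart v) (w ++ others) [ i ]))
    where others = filterᵇ (λ j → not ⌊ j ≟F i ⌋) (incident G v)

  reduced : Fin (m G) → ℕ
  reduced i = k i ∸ 1

  prefixes : Vertex → List (List (Fin (m G)))
  prefixes v = words reduced (incident G v)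

  arrangements : List (Vec (List (Fin (m G))) (n G))
  arrangements = choices (n G) prefixes

  queues : Vec (List (Fin (m G))) (n G) → Queues
  queues σ v = map (outDart v) (lookup σ v ++ exitOrder v (root-or-parent v))

  module _ {σ} (σ∈ : σ ∈ arrangements) where

    queues-outgoing : Outgoing (queues σ)
    queues-outgoing v d∈ with j , j∈ , refl ← ∈-map⁻ (outDart v) d∈ with ∈-++⁻ (lookup σ v) j∈
    ... | inj₁ j∈prefix = outDart-tail (∈-incident⁻ (words-⊆ (incident G v) (∈-choices⁻ (n G) prefixes σ∈ v) j∈prefix))
    ... | inj₂ j∈exits = outDart-tail (exitOrder-incident v (root-or-parent v) j∈exits)

    queues-sized : ∀ d → countDart G d (queues σ (dtail G d)) ≡ k (proj₁ d)
    queues-sized (i , b) = begin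
      countDart G (i , b) (map (outDart v) L)               ≡⟨ countᵇ-map _ (outDart v) L ⟩
      countᵇ (λ j → _≟D_ {G} (outDart v j) (i , b)) L       ≡⟨ countᵇ-cong picks-i L ⟩
      occurrences i (lookup σ v ++ exits)                   ≡⟨ countᵇ-++ _ (lookup σ v) exits ⟩
      occurrences i (lookup σ v) + occurrences i exits      ≡⟨ cong₂ _+_ in-prefix in-exits ⟩
      k i ∸ 1 + 1                                           ≡⟨ m∸n+n≡m (k>0 i) ⟩
      k i                                                   ∎
      where
      open ≡-Reasoning
      v = dtail G (i , b)
      exits = exitOrder v (root-or-parent v)
      L = lookup σ v ++ exits
      picks-i : ∀ j → _≟D_ {G} (outDart v j) (i , b) ≡ ⌊ j ≟F i ⌋
      picks-i j with j ≟F i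
      ... | yes refl = ⌊⌋-true (_ ≟B b) (cong proj₂ (outDart-dtail (i , b)))
      ... | no _ = refl
      in-prefix : occurrences i (lookup σ v) ≡ k i ∸ 1
      in-prefix = words-occurrences (incident-unique v) (∈-choices⁻ (n G) prefixes σ∈ v) (∈-incident⁺ (isIncident-dtail (i , b)))
      in-exits : occurrences i exits ≡ 1
      in-exits = occurrences-unique (exitOrder-unique v (root-or-parent v)) (∈-exitOrder v (root-or-parent v) (isIncident-dtail (i , b)))

    open Runs.Exhaustion G k u (queues σ) queues-outgoing queues-sized depth
           (λ v → exitOrder-last v (root-or-parent v) (lookup σ v)) public
      using (closed; all-used; length-tour; leavingFrom-tour)

  tour : Vec (List (Fin (m G))) (n G) → List (Dart G)
  tour σ = trail (follow (∑ (λ i → k i + k i)) (queues σ) u)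

  tour-injective : ∀ {σ τ} → σ ∈ arrangements → τ ∈ arrangements → tour σ ≡ tour τ → σ ≡ τ
  tour-injective {σ} {τ} σ∈ τ∈ same-tour = lookup-extensionality λ v →
    ++-cancelʳ (exitOrder v (root-or-parent v)) (lookup σ v) (lookup τ v)
      (map-injective (cong proj₁)
        (trans (sym (leavingFrom-tour σ∈ v)) (trans (cong (leavingFrom v) same-tour) (leavingFrom-tour τ∈ v))))

  twice-total≡fuel : 2 * sum (map k (allFin (m G))) ≡ ∑ (λ i → k i + k i)
  twice-total≡fuel = begin
    2 * sum (map k (allFin (m G)))  ≡⟨ cong (λ xs → 2 * sum xs) (map-tabulate id k) ⟩
    2 * ∑ k                         ≡⟨ cong (∑ k +_) (+-identityʳ (∑ k)) ⟩
    ∑ k + ∑ k                       ≡⟨ ∑-distrib-+ k k ⟨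
    ∑ (λ i → k i + k i)             ∎
    where open ≡-Reasoning

  counted : List (List (Dart G))
  counted = filterᵇ (λ ds → isWalkᵇ G u u ds ∧ hasCountsᵇ G k ds) (seqs G (2 * sum (map k (allFin (m G)))))

  tours⊆counted : ∀ {ds} → ds ∈ map tour arrangements → ds ∈ counted
  tours⊆counted ds∈ with σ , σ∈ , refl ← ∈-map⁻ tour ds∈ =
    ∈-filterᵇ⁺ (subst (λ L → tour σ ∈ seqs G L) (trans (length-tour σ∈) (sym twice-total≡fuel)) (∈-seqs (tour σ)))
      (cong₂ _∧_ (Walk⇒isWalkᵇ (closed σ∈))
                 (and-map-true _ (allFin (m G)) λ i →
                   cong₂ _∧_ (≡⇒≡ᵇ-true (all-used σ∈ (i , true))) (≡⇒≡ᵇ-true (all-used σ∈ (i , false)))))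

  localFactor≡#prefixes : ∀ v → localFactor G k v ≡ length (prefixes v)
  localFactor≡#prefixes v = trans (/-congˡ (sym (length-words reduced (incident G v)))) (m*n/n≡m (length (prefixes v)) _)
    where instance _ = prod!≢0 (map reduced (incident G v))

  boundWB≡#arrangements : boundWB G k ≡ length arrangements
  boundWB≡#arrangements = begin
    product (map (localFactor G k) (allFin (n G)))  ≡⟨ cong product (map-tabulate id (localFactor G k)) ⟩
    product (tabulate (localFactor G k))           ≡⟨ cong product (tabulate-cong localFactor≡#prefixes) ⟩
    product (tabulate (length ∘ prefixes))         ≡⟨ length-choices (n G) prefixes ⟨
    length arrangements                             ∎
    where open ≡-Reasoning

  tours-unique : Unique (map tour arrangements)
  tours-unique = Unique-map-injectiveOn tour
    (choices-unique (n G) prefixes λ v → words-unique reduced (incident-unique v)) tour-injective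

lemma2p4 : (G : Graph) → Connected G → (k : Fin (m G) → ℕ) → (∀ i → k i > 0) →
    (u : Fin (n G)) → boundWB G k ≤ WB G k u
lemma2p4 G conn k k>0 u = begin
  boundWB G k                     ≡⟨ boundWB≡#arrangements ⟩
  length arrangements             ≡⟨ length-map tour arrangements ⟨
  length (map tour arrangements)  ≤⟨ Unique-⊆⇒length≤ tours-unique tours⊆counted ⟩
  length counted                  ∎
  where
  open Arrangements G conn k k>0 u
  open ≤-Reasoning
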